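{- Let $G$ and $H$ be finite simple graphs, each with at least one vertex. Then the join $G+H$ satisfies $p(G+H)=2$ and \[ P(G+H)=\alpha(G+H)+1=\max(\alpha(G),\alpha(H))+1. \]
   Context: The join $G+H$ has vertex set $V(G)\cup V(H)$ (disjoint) and edge set $E(G)\cup E(H)\cup\{gh : g\in V(G), h\in V(H)\}$. $\alpha(\cdot)$ denotes the independence number. A distribution of pegs on a graph $\Gamma$ is a subset $D \subseteq V(\Gamma)$. If $u,v \in D$ are distinct adjacent vertices and $w \notin D$ is a vertex adjacent to $v$, the pegging move (jumping $u$ over $v$ into $w$) replaces $D$ by $(D\setminus\{u,v\})\cup\{w\}$. A vertex $t$ is reachable from $D$ if some finite (possibly empty) sequence of pegging moves starting from $D$ ends in a distribution containing $t$; $\mathrm{Reach}(D)$ is the set of reachable vertices. The pegging number $P(\Gamma)$ (resp. optimal pegging number $p(\Gamma)$) is the smallest positive integer $d$ such that every (resp. some) distribution of size $d$ on $\Gamma$ has reach $V(\Gamma)$. -}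

module Defs where

open import Data.Nat using (ℕ; zero; suc; _+_; _≤_; _<_)
open import Data.Bool using (Bool; true; false)
open import Data.Fin using (Fin; splitAt)
open import Data.Fin.Subset using (Subset; _∈_; _∉_; _-_; _∪_; ⁅_⁆; ∣_∣)
open import Data.Sum using (_⊎_; inj₁; inj₂)
open import Data.Product using (Σ; _×_; _,_; ∃)
open import Relation.Binary.PropositionalEquality using (_≡_; refl; _≢_)
open import Relation.Nullary using (¬_)
open import Relation.Binary.Construct.Closure.ReflexiveTransitive using (Star)

record Graph (n : ℕ) : Set where
  field
    adj    : Fin n → Fin n → Bool
    sym    : ∀ u v → adj u v ≡ adj v u
    irrefl : ∀ v → adj v v ≡ false

open Graph public

Edge : ∀ {n} → Graph n → Fin n → Fin n → Set
Edge Γ u v = adj Γ u v ≡ true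

joinAdj : ∀ {m n} → Graph m → Graph n → Fin (m + n) → Fin (m + n) → Bool
joinAdj {m} G H x y with splitAt m x | splitAt m y
... | inj₁ a | inj₁ b = adj G a b
... | inj₂ a | inj₂ b = adj H a b
... | inj₁ _ | inj₂ _ = true
... | inj₂ _ | inj₁ _ = true

joinSym : ∀ {m n} (G : Graph m) (H : Graph n) x y → joinAdj G H x y ≡ joinAdj G H y x
joinSym {m} G H x y with splitAt m x | splitAt m y
... | inj₁ a | inj₁ b = sym G a b
... | inj₂ a | inj₂ b = sym H a b
... | inj₁ _ | inj₂ _ = refl
... | inj₂ _ | inj₁ _ = refl

joinIrrefl : ∀ {m n} (G : Graph m) (H : Graph n) x → joinAdj G H x x ≡ false
joinIrrefl {m} G H x with splitAt m x
... | inj₁ a = irrefl G a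
... | inj₂ a = irrefl H a

_⊕_ : ∀ {m n} → Graph m → Graph n → Graph (m + n)
G ⊕ H = record { adj = joinAdj G H ; sym = joinSym G H ; irrefl = joinIrrefl G H }

Independent : ∀ {n} → Graph n → Subset n → Set
Independent Γ S = ∀ u v → u ∈ S → v ∈ S → ¬ Edge Γ u v

IsIndependenceNumber : ∀ {n} → Graph n → ℕ → Set
IsIndependenceNumber Γ a =
  (Σ (Subset _) λ S → Independent Γ S × ∣ S ∣ ≡ a)
  × (∀ S → Independent Γ S → ∣ S ∣ ≤ a)

data Move {n} (Γ : Graph n) (D : Subset n) : Subset n → Set where
  jump : ∀ u v w → u ≢ v → u ∈ D → v ∈ D → Edge Γ u v → w ∉ D → Edge Γ v w →
         Move Γ D (((D - u) - v) ∪ ⁅ w ⁆)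

Reachable : ∀ {n} → Graph n → Subset n → Fin n → Set
Reachable Γ D t = Σ (Subset _) λ D' → Star (Move Γ) D D' × t ∈ D'

FullReach : ∀ {n} → Graph n → Subset n → Set
FullReach Γ D = ∀ t → Reachable Γ D t

AllFull : ∀ {n} → Graph n → ℕ → Set
AllFull Γ d = ∀ D → ∣ D ∣ ≡ d → FullReach Γ D

SomeFull : ∀ {n} → Graph n → ℕ → Set
SomeFull Γ d = Σ (Subset _) λ D → ∣ D ∣ ≡ d × FullReach Γ D

IsPeggingNumber : ∀ {n} → Graph n → ℕ → Set
IsPeggingNumber Γ d = 1 ≤ d × AllFull Γ d × (∀ d' → 1 ≤ d' → d' < d → ¬ AllFull Γ d')

IsOptimalPeggingNumber : ∀ {n} → Graph n → ℕ → Set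
IsOptimalPeggingNumber Γ d = 1 ≤ d × SomeFull Γ d × (∀ d' → 1 ≤ d' → d' < d → ¬ SomeFull Γ d')

-- Let D be a
-- distribution with α(G + H) + 1 pegs and t an empty target. D is not
-- independent, so it contains adjacent pegs u, v; if neither is adjacent to t,
-- both lie on the side of t, and a vertex h on the other side is adjacent to all
-- three. A peg on h, or a further peg w on the other side, gives a single jump
-- into t; a further peg w on the side of t jumps over h after u has jumped over
-- v into h. Conversely an independent distribution admits no move, so no
-- distribution of size at most α is guaranteed to reach everything, and a single
-- peg never moves, while one peg on each side reaches every vertex. Finally an
-- independent set of G + H cannot meet both sides, so α(G + H) = max(α(G), α(H)).
module Submission where

open import Defs hiding (sym)
open import Data.Bool using (Bool; true; false)
open import Data.Bool.Properties using () renaming (_≟_ to _≟ᵇ_)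
open import Data.Empty using (⊥-elim)
open import Data.Fin using (Fin; zero; suc; splitAt; _↑ˡ_; _↑ʳ_) renaming (_≟_ to _≟ᶠ_)
open import Data.Fin.Properties using (splitAt-↑ˡ; splitAt-↑ʳ; any?; all?)
open import Data.Fin.Subset using (Subset; _∈_; _∉_; _-_; _∪_; ⁅_⁆; ∣_∣; inside; outside; ⊥; _⊆_)
open import Data.Fin.Subset.Properties
  using (_∈?_; x∈⁅x⁆; x∈⁅y⁆⇒x≡y; x≢y⇒x∉⁅y⁆; ∣⁅x⁆∣≡1; ∉⊥; ∣⊥∣≡0; ∪-identityʳ; x∈p∪q⁺; x∈p∪q⁻;
         x∈p∧x≢y⇒x∈p-y; p─q⊆p; x∈p⇒∣p-x∣<∣p∣; p⊆q⇒∣p∣≤∣q∣; s⊆s; out⊆; nonempty?; Empty-unique)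
open import Data.Nat using (ℕ; zero; suc; _+_; _≤_; _<_; _⊔_; z≤n; s≤s; s≤s⁻¹)
open import Data.Nat.Properties using (≤-trans; ≤-total; 1+n≰n; m≤m⊔n; m≤n⊔m; m≤n⇒m⊔n≡n; m≥n⇒m⊔n≡m)
open import Data.Product using (Σ; ∃; ∃₂; _×_; _,_)
open import Data.Sum using (_⊎_; inj₁; inj₂; [_,_]′)
open import Data.Vec using ([]; _∷_; _++_; here; there)
import Data.Vec as Vec
open import Function using (const)
open import Relation.Binary.Construct.Closure.ReflexiveTransitive using (ε; _◅_)
open import Relation.Binary.PropositionalEquality using (_≡_; refl; _≢_; sym; trans; cong; subst; subst₂)
open import Relation.Nullary using (¬_; Dec; yes; no; contradiction)
open import Relation.Nullary.Decidable using (_→-dec_; _×-dec_; ¬?)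
open import Relation.Unary using (Decidable)

private
  variable
    k m n c d : ℕ
    x y t u v w h : Fin k
    p q D : Subset k

∣p∪⁅x⁆∣≡1+∣p∣ : x ∉ p → ∣ p ∪ ⁅ x ⁆ ∣ ≡ suc ∣ p ∣
∣p∪⁅x⁆∣≡1+∣p∣ {x = zero}  {p = inside  ∷ p} x∉p = contradiction here x∉p
∣p∪⁅x⁆∣≡1+∣p∣ {x = zero}  {p = outside ∷ p} x∉p = cong (λ r → suc ∣ r ∣) (∪-identityʳ p)
∣p∪⁅x⁆∣≡1+∣p∣ {x = suc x} {p = inside  ∷ p} x∉p = cong suc (∣p∪⁅x⁆∣≡1+∣p∣ (λ x∈p → x∉p (there x∈p)))
∣p∪⁅x⁆∣≡1+∣p∣ {x = suc x} {p = outside ∷ p} x∉p = ∣p∪⁅x⁆∣≡1+∣p∣ (λ x∈p → x∉p (there x∈p))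

∣⁅x⁆∪⁅y⁆∣≡2 : x ≢ y → ∣ ⁅ x ⁆ ∪ ⁅ y ⁆ ∣ ≡ 2
∣⁅x⁆∪⁅y⁆∣≡2 {x = x} x≢y = trans (∣p∪⁅x⁆∣≡1+∣p∣ (x≢y⇒x∉⁅y⁆ (λ y≡x → x≢y (sym y≡x)))) (cong suc (∣⁅x⁆∣≡1 x))

x∈⁅x⁆∪⁅y⁆ : x ∈ ⁅ x ⁆ ∪ ⁅ y ⁆
x∈⁅x⁆∪⁅y⁆ {x = x} = x∈p∪q⁺ (inj₁ (x∈⁅x⁆ x))

y∈⁅x⁆∪⁅y⁆ : y ∈ ⁅ x ⁆ ∪ ⁅ y ⁆
y∈⁅x⁆∪⁅y⁆ {y = y} = x∈p∪q⁺ (inj₂ (x∈⁅x⁆ y))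

z∈⁅x⁆∪⁅y⁆⇒z≡x⊎z≡y : ∀ {z} → z ∈ ⁅ x ⁆ ∪ ⁅ y ⁆ → z ≡ x ⊎ z ≡ y
z∈⁅x⁆∪⁅y⁆⇒z≡x⊎z≡y {x = x} {y = y} z∈ with x∈p∪q⁻ ⁅ x ⁆ ⁅ y ⁆ z∈
... | inj₁ z∈⁅x⁆ = inj₁ (x∈⁅y⁆⇒x≡y x z∈⁅x⁆)
... | inj₂ z∈⁅y⁆ = inj₂ (x∈⁅y⁆⇒x≡y y z∈⁅y⁆)

2≤∣p∣ : x ∈ p → y ∈ p → x ≢ y → 2 ≤ ∣ p ∣
2≤∣p∣ x∈p y∈p x≢y =
  ≤-trans (s≤s (≤-trans (s≤s z≤n) (x∈p⇒∣p-x∣<∣p∣ y∈p-x))) (x∈p⇒∣p-x∣<∣p∣ x∈p)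
  where y∈p-x = x∈p∧x≢y⇒x∈p-y y∈p (λ y≡x → x≢y (sym y≡x))

∈-++ˡ⁺ : ∀ {p : Subset m} {q : Subset n} {i} → i ∈ p → i ↑ˡ n ∈ p ++ q
∈-++ˡ⁺ here = here
∈-++ˡ⁺ (there i∈p) = there (∈-++ˡ⁺ i∈p)

∈-++ʳ⁺ : ∀ (p : Subset m) {q : Subset n} {j} → j ∈ q → m ↑ʳ j ∈ p ++ q
∈-++ʳ⁺ [] j∈q = j∈q
∈-++ʳ⁺ (_ ∷ p) j∈q = there (∈-++ʳ⁺ p j∈q)

∈-++⁻ : ∀ (p : Subset m) {q : Subset n} {x} → x ∈ p ++ q →
        (∃ λ i → x ≡ i ↑ˡ n × i ∈ p) ⊎ (∃ λ j → x ≡ m ↑ʳ j × j ∈ q)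
∈-++⁻ [] x∈q = inj₂ (_ , refl , x∈q)
∈-++⁻ (_ ∷ p) here = inj₁ (zero , refl , here)
∈-++⁻ (_ ∷ p) (there x∈) with ∈-++⁻ p x∈
... | inj₁ (i , refl , i∈p) = inj₁ (suc i , refl , there i∈p)
... | inj₂ (j , refl , j∈q) = inj₂ (j , refl , j∈q)

x∈p∧y∈q⇒¬[p≡⊥⊎q≡⊥] : x ∈ p → y ∈ q → ¬ (p ≡ ⊥ ⊎ q ≡ ⊥)
x∈p∧y∈q⇒¬[p≡⊥⊎q≡⊥] x∈p _ (inj₁ refl) = ∉⊥ x∈p
x∈p∧y∈q⇒¬[p≡⊥⊎q≡⊥] _ y∈q (inj₂ refl) = ∉⊥ y∈q

∣⊥++q∣≡∣q∣ : ∀ m (q : Subset n) → ∣ ⊥ {n = m} ++ q ∣ ≡ ∣ q ∣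
∣⊥++q∣≡∣q∣ zero    q = refl
∣⊥++q∣≡∣q∣ (suc m) q = ∣⊥++q∣≡∣q∣ m q

∣p++⊥∣≡∣p∣ : ∀ (p : Subset m) → ∣ p ++ ⊥ {n = n} ∣ ≡ ∣ p ∣
∣p++⊥∣≡∣p∣ {n = n} [] = ∣⊥∣≡0 n
∣p++⊥∣≡∣p∣ (inside ∷ p) = cong suc (∣p++⊥∣≡∣p∣ p)
∣p++⊥∣≡∣p∣ (outside ∷ p) = ∣p++⊥∣≡∣p∣ p

subsetOfSize : ∀ (p : Subset k) → d ≤ ∣ p ∣ → ∃ λ q → q ⊆ p × ∣ q ∣ ≡ d
subsetOfSize [] z≤n = [] , (λ x∈q → x∈q) , refl
subsetOfSize (outside ∷ p) d≤∣p∣ with subsetOfSize p d≤∣p∣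
... | q , q⊆p , ∣q∣≡d = outside ∷ q , out⊆ q⊆p , ∣q∣≡d
subsetOfSize {k = suc k} {d = zero} (inside ∷ p) _ = ⊥ , (λ x∈⊥ → contradiction x∈⊥ ∉⊥) , ∣⊥∣≡0 (suc k)
subsetOfSize {d = suc d} (inside ∷ p) (s≤s d≤∣p∣) with subsetOfSize p d≤∣p∣
... | q , q⊆p , ∣q∣≡d = inside ∷ q , s⊆s q⊆p , cong suc ∣q∣≡d

maximumSubset : ∀ {P : Subset k → Set} → Decidable P →
                (∀ p → ¬ P p) ⊎ ∃ λ p → P p × (∀ q → P q → ∣ q ∣ ≤ ∣ p ∣)
maximumSubset {zero} P? with P? []
... | yes P[] = inj₂ ([] , P[] , λ { [] _ → z≤n })
... | no ¬P[] = inj₁ λ { [] → ¬P[] }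
maximumSubset {suc k} P? with maximumSubset (λ q → P? (outside ∷ q)) | maximumSubset (λ q → P? (inside ∷ q))
... | inj₁ none₀ | inj₁ none₁ = inj₁ λ { (outside ∷ q) → none₀ q ; (inside ∷ q) → none₁ q }
... | inj₂ (p , Pp , max) | inj₁ none₁ =
  inj₂ (outside ∷ p , Pp , λ { (outside ∷ q) Pq → max q Pq ; (inside ∷ q) Pq → contradiction Pq (none₁ q) })
... | inj₁ none₀ | inj₂ (p , Pp , max) =
  inj₂ (inside ∷ p , Pp , λ { (outside ∷ q) Pq → contradiction Pq (none₀ q) ; (inside ∷ q) Pq → s≤s (max q Pq) })
... | inj₂ (p₀ , Pp₀ , max₀) | inj₂ (p₁ , Pp₁ , max₁) with ≤-total ∣ p₀ ∣ (suc ∣ p₁ ∣)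
...   | inj₁ ≤₁ = inj₂ (inside ∷ p₁ , Pp₁ ,
          λ { (outside ∷ q) Pq → ≤-trans (max₀ q Pq) ≤₁ ; (inside ∷ q) Pq → s≤s (max₁ q Pq) })
...   | inj₂ ≤₀ = inj₂ (outside ∷ p₀ , Pp₀ ,
          λ { (outside ∷ q) Pq → max₀ q Pq ; (inside ∷ q) Pq → ≤-trans (s≤s (max₁ q Pq)) ≤₀ })

module _ (Γ : Graph k) where

  edge? : ∀ u v → Dec (Edge Γ u v)
  edge? u v = adj Γ u v ≟ᵇ true

  independent? : Decidable (Independent Γ)
  independent? S = all? λ u → all? λ v → u ∈? S →-dec (v ∈? S →-dec ¬? (edge? u v))

  edge⇒≢ : Edge Γ u v → u ≢ v
  edge⇒≢ {u = u} uv refl = contradiction (trans (sym uv) (irrefl Γ u)) λ ()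

  edge-sym : Edge Γ u v → Edge Γ v u
  edge-sym {u = u} {v = v} uv = trans (Graph.sym Γ v u) uv

  independenceNumber : ∃ (IsIndependenceNumber Γ)
  independenceNumber with maximumSubset independent?
  ... | inj₁ none = ⊥-elim (none ⊥ λ _ _ u∈⊥ _ → contradiction u∈⊥ ∉⊥)
  ... | inj₂ (S , indS , maxS) = ∣ S ∣ , (S , indS , refl) , maxS

  ⁅x⁆∪⁅y⁆-independent : ¬ Edge Γ x y → Independent Γ (⁅ x ⁆ ∪ ⁅ y ⁆)
  ⁅x⁆∪⁅y⁆-independent ¬xy u v u∈ v∈ uv
    with z∈⁅x⁆∪⁅y⁆⇒z≡x⊎z≡y u∈ | z∈⁅x⁆∪⁅y⁆⇒z≡x⊎z≡y v∈
  ... | inj₁ refl | inj₁ refl = edge⇒≢ uv refl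
  ... | inj₂ refl | inj₂ refl = edge⇒≢ uv refl
  ... | inj₁ refl | inj₂ refl = ¬xy uv
  ... | inj₂ refl | inj₁ refl = ¬xy (edge-sym uv)

  ∣D∣≡1⇒independent : ∣ D ∣ ≡ 1 → Independent Γ D
  ∣D∣≡1⇒independent ∣D∣≡1 u v u∈D v∈D uv with subst (2 ≤_) ∣D∣≡1 (2≤∣p∣ u∈D v∈D (edge⇒≢ uv))
  ... | s≤s ()

  edgeInLargeDistribution : (∀ S → Independent Γ S → ∣ S ∣ ≤ c) → ∣ D ∣ ≡ suc c →
                            ∃₂ λ u v → u ∈ D × v ∈ D × Edge Γ u v
  edgeInLargeDistribution {c = c} {D = D} bound ∣D∣≡1+c
    with any? (λ u → any? λ v → u ∈? D ×-dec (v ∈? D ×-dec edge? u v))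
  ... | yes found = found
  ... | no none = contradiction (subst (_≤ c) ∣D∣≡1+c (bound D indD)) 1+n≰n
    where
    indD : Independent Γ D
    indD u v u∈D v∈D uv = none (u , v , u∈D , v∈D , uv)

  -- If every peg were u or v then |D| ≤ 2, whereas the independent set {v, t} forces α ≥ 2.
  thirdPeg : (∀ S → Independent Γ S → ∣ S ∣ ≤ c) → ∣ D ∣ ≡ suc c →
             u ≢ v → v ∈ D → t ∉ D → ¬ Edge Γ v t → ∃ λ w → w ∈ D × w ≢ u × w ≢ v
  thirdPeg {c = c} {D = D} {u = u} {v = v} bound ∣D∣≡1+c u≢v v∈D t∉D ¬vt
    with any? (λ w → w ∈? D ×-dec (¬? (w ≟ᶠ u) ×-dec ¬? (w ≟ᶠ v)))
  ... | yes found = found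
  ... | no none = contradiction (≤-trans (s≤s 2≤c) 1+c≤2) λ { (s≤s (s≤s ())) }
    where
    2≤c : 2 ≤ c
    2≤c = subst (_≤ c) (∣⁅x⁆∪⁅y⁆∣≡2 (λ v≡t → t∉D (subst (_∈ D) v≡t v∈D)))
                (bound _ (⁅x⁆∪⁅y⁆-independent ¬vt))
    D⊆⁅u⁆∪⁅v⁆ : D ⊆ ⁅ u ⁆ ∪ ⁅ v ⁆
    D⊆⁅u⁆∪⁅v⁆ {w} w∈D with w ≟ᶠ u | w ≟ᶠ v
    ... | yes refl | _        = x∈⁅x⁆∪⁅y⁆
    ... | no _     | yes refl = y∈⁅x⁆∪⁅y⁆
    ... | no w≢u   | no w≢v   = contradiction (w , w∈D , w≢u , w≢v) none
    1+c≤2 : suc c ≤ 2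
    1+c≤2 = subst₂ _≤_ ∣D∣≡1+c (∣⁅x⁆∪⁅y⁆∣≡2 u≢v) (p⊆q⇒∣p∣≤∣q∣ D⊆⁅u⁆∪⁅v⁆)

  reachable-independent⇒∈ : Independent Γ D → Reachable Γ D t → t ∈ D
  reachable-independent⇒∈ indD (_ , ε , t∈D) = t∈D
  reachable-independent⇒∈ indD (_ , jump u v _ _ u∈D v∈D uv _ _ ◅ _ , _) = ⊥-elim (indD u v u∈D v∈D uv)

  independent⇒¬AllFull : Edge Γ x y → ∀ {S} → Independent Γ S → d ≤ ∣ S ∣ → ¬ AllFull Γ d
  independent⇒¬AllFull {x = x} {y = y} xy {S} indS d≤∣S∣ allFull with subsetOfSize S d≤∣S∣
  ... | S′ , S′⊆S , ∣S′∣≡d = indS x y (S′⊆S (stuck x)) (S′⊆S (stuck y)) xy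
    where
    stuck : ∀ t → t ∈ S′
    stuck t = reachable-independent⇒∈ (λ u v u∈ v∈ → indS u v (S′⊆S u∈) (S′⊆S v∈)) (allFull S′ ∣S′∣≡d t)

  ¬SomeFull-1 : Edge Γ x y → ¬ SomeFull Γ 1
  ¬SomeFull-1 {x = x} {y = y} xy (D , ∣D∣≡1 , full) = indD x y (stuck x) (stuck y) xy
    where
    indD = ∣D∣≡1⇒independent ∣D∣≡1
    stuck : ∀ t → t ∈ D
    stuck t = reachable-independent⇒∈ indD (full t)

  reachable-◅ : ∀ {D′} → Move Γ D D′ → Reachable Γ D′ t → Reachable Γ D t
  reachable-◅ move (D″ , moves , t∈D″) = D″ , move ◅ moves , t∈D″

  reachableByJump : u ∈ D → v ∈ D → Edge Γ u v → t ∉ D → Edge Γ v t → Reachable Γ D t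
  reachableByJump {t = t} u∈D v∈D uv t∉D vt =
    reachable-◅ (jump _ _ t (edge⇒≢ uv) u∈D v∈D uv t∉D vt) (_ , ε , x∈p∪q⁺ (inj₂ (x∈⁅x⁆ t)))

  reachableByTwoJumps : u ∈ D → v ∈ D → Edge Γ u v → h ∉ D → Edge Γ v h →
                        w ∈ D → w ≢ u → w ≢ v → Edge Γ w h → t ∉ D → Edge Γ h t → Reachable Γ D t
  reachableByTwoJumps {D = D} {h = h} {t = t} u∈D v∈D uv h∉D vh w∈D w≢u w≢v wh t∉D ht =
    reachable-◅ (jump _ _ h (edge⇒≢ uv) u∈D v∈D uv h∉D vh)
      (reachableByJump (x∈p∪q⁺ (inj₁ (x∈p∧x≢y⇒x∈p-y (x∈p∧x≢y⇒x∈p-y w∈D w≢u) w≢v)))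
                       (x∈p∪q⁺ (inj₂ (x∈⁅x⁆ h))) wh t∉D′ ht)
    where
    t∉D′ : t ∉ ((D - _) - _) ∪ ⁅ h ⁆
    t∉D′ t∈D′ with x∈p∪q⁻ _ ⁅ h ⁆ t∈D′
    ... | inj₁ t∈D-u-v = t∉D (p─q⊆p D _ (p─q⊆p _ _ t∈D-u-v))
    ... | inj₂ t∈⁅h⁆ = edge⇒≢ ht (sym (x∈⁅y⁆⇒x≡y h t∈⁅h⁆))

record JoinSplitting (Γ : Graph k) : Set where
  field
    side       : Fin k → Bool
    across     : side x ≢ side y → Edge Γ x y
    left right : Fin k
    left≢right : side left ≢ side right

module _ {Γ : Graph k} (J : JoinSplitting Γ) where
  open JoinSplitting J

  opposite : ∀ t → ∃ λ h → side h ≢ side t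
  opposite t with side t ≟ᵇ side left
  ... | yes t~left = right , λ right~t → left≢right (trans (sym t~left) (sym right~t))
  ... | no  t≁left = left , λ left~t → t≁left (sym left~t)

  ¬edge⇒sameSide : ¬ Edge Γ x y → side x ≡ side y
  ¬edge⇒sameSide {x = x} {y = y} ¬xy with side x ≟ᵇ side y
  ... | yes x~y = x~y
  ... | no  x≁y = contradiction (across x≁y) ¬xy

  edgeToOpposite : side x ≡ side t → side h ≢ side t → Edge Γ x h
  edgeToOpposite x~t h≁t = across λ x~h → h≁t (trans (sym x~h) x~t)

  left-right : Edge Γ left right
  left-right = across left≢right

  reachableViaEdge : (∀ S → Independent Γ S → ∣ S ∣ ≤ c) → ∣ D ∣ ≡ suc c →
                     u ∈ D → v ∈ D → Edge Γ u v → t ∉ D → Reachable Γ D t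
  reachableViaEdge {D = D} {u = u} {v = v} {t = t} bound ∣D∣≡1+c u∈D v∈D uv t∉D
    with edge? Γ v t | edge? Γ u t
  ... | yes vt | _      = reachableByJump Γ u∈D v∈D uv t∉D vt
  ... | no _   | yes ut = reachableByJump Γ v∈D u∈D (edge-sym Γ uv) t∉D ut
  ... | no ¬vt | no ¬ut with opposite t
  ... | h , h≁t with h ∈? D
  ... | yes h∈D = reachableByJump Γ u∈D h∈D (edgeToOpposite u~t h≁t) t∉D (across h≁t)
    where u~t = ¬edge⇒sameSide ¬ut
  ... | no h∉D with thirdPeg Γ bound ∣D∣≡1+c (edge⇒≢ Γ uv) v∈D t∉D ¬vt
  ... | w , w∈D , w≢u , w≢v with side w ≟ᵇ side t
  ... | no w≁t = reachableByJump Γ u∈D w∈D (edgeToOpposite (¬edge⇒sameSide ¬ut) w≁t) t∉D (across w≁t)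
  ... | yes w~t = reachableByTwoJumps Γ u∈D v∈D uv h∉D (edgeToOpposite (¬edge⇒sameSide ¬vt) h≁t)
                    w∈D w≢u w≢v (edgeToOpposite w~t h≁t) t∉D (across h≁t)

  allFull : (∀ S → Independent Γ S → ∣ S ∣ ≤ c) → AllFull Γ (suc c)
  allFull bound D ∣D∣≡1+c t with t ∈? D
  ... | yes t∈D = D , ε , t∈D
  ... | no t∉D with edgeInLargeDistribution Γ bound ∣D∣≡1+c
  ... | u , v , u∈D , v∈D , uv = reachableViaEdge bound ∣D∣≡1+c u∈D v∈D uv t∉D

  someFull-2 : SomeFull Γ 2
  someFull-2 = ⁅ left ⁆ ∪ ⁅ right ⁆ , ∣⁅x⁆∪⁅y⁆∣≡2 (edge⇒≢ Γ left-right) , full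
    where
    full : FullReach Γ (⁅ left ⁆ ∪ ⁅ right ⁆)
    full t with t ∈? ⁅ left ⁆ ∪ ⁅ right ⁆ | side t ≟ᵇ side right
    ... | yes t∈ | _ = _ , ε , t∈
    ... | no t∉ | yes t~right = reachableByJump Γ y∈⁅x⁆∪⁅y⁆ x∈⁅x⁆∪⁅y⁆ (edge-sym Γ left-right) t∉
                                  (across λ left~t → left≢right (trans left~t t~right))
    ... | no t∉ | no t≁right = reachableByJump Γ x∈⁅x⁆∪⁅y⁆ y∈⁅x⁆∪⁅y⁆ left-right t∉
                                 (across λ right~t → t≁right (sym right~t))

  isOptimalPeggingNumber-2 : IsOptimalPeggingNumber Γ 2
  isOptimalPeggingNumber-2 = s≤s z≤n , someFull-2 , below
    where
    below : ∀ d → 1 ≤ d → d < 2 → ¬ SomeFull Γ d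
    below 1 _ _ = ¬SomeFull-1 Γ left-right
    below (suc (suc _)) _ (s≤s (s≤s ()))

  isPeggingNumber : IsIndependenceNumber Γ c → IsPeggingNumber Γ (suc c)
  isPeggingNumber ((S , indS , ∣S∣≡c) , bound) =
    s≤s z≤n , allFull bound ,
    λ d _ d<1+c → independent⇒¬AllFull Γ left-right indS (subst (d ≤_) (sym ∣S∣≡c) (s≤s⁻¹ d<1+c))

module _ (G : Graph m) (H : Graph n) where

  inG : Fin (m + n) → Bool
  inG x = [ const true , const false ]′ (splitAt m x)

  inG-↑ʳ : ∀ j → inG (m ↑ʳ j) ≡ false
  inG-↑ʳ j = cong [ const true , const false ]′ (splitAt-↑ʳ m n j)

  ⊕-across : inG x ≢ inG y → Edge (G ⊕ H) x y
  ⊕-across {x = x} {y = y} x≁y with splitAt m x | splitAt m y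
  ... | inj₁ _ | inj₁ _ = contradiction refl x≁y
  ... | inj₂ _ | inj₂ _ = contradiction refl x≁y
  ... | inj₁ _ | inj₂ _ = refl
  ... | inj₂ _ | inj₁ _ = refl

  adj-↑ˡ : ∀ i j → adj (G ⊕ H) (i ↑ˡ n) (j ↑ˡ n) ≡ adj G i j
  adj-↑ˡ i j rewrite splitAt-↑ˡ m i n | splitAt-↑ˡ m j n = refl

  adj-↑ʳ : ∀ i j → adj (G ⊕ H) (m ↑ʳ i) (m ↑ʳ j) ≡ adj H i j
  adj-↑ʳ i j rewrite splitAt-↑ʳ m n i | splitAt-↑ʳ m n j = refl

  edge-↑ˡ-↑ʳ : ∀ i j → Edge (G ⊕ H) (i ↑ˡ n) (m ↑ʳ j)
  edge-↑ˡ-↑ʳ i j rewrite splitAt-↑ˡ m i n | splitAt-↑ʳ m n j = refl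

  independent-++⁺ : ∀ {p q} → Independent G p → Independent H q → p ≡ ⊥ ⊎ q ≡ ⊥ →
                    Independent (G ⊕ H) (p ++ q)
  independent-++⁺ {p} {q} indG indH p≡⊥⊎q≡⊥ x y x∈ y∈ xy with ∈-++⁻ p x∈ | ∈-++⁻ p y∈
  ... | inj₁ (i , refl , i∈p) | inj₁ (j , refl , j∈p) = indG i j i∈p j∈p (trans (sym (adj-↑ˡ i j)) xy)
  ... | inj₂ (i , refl , i∈q) | inj₂ (j , refl , j∈q) = indH i j i∈q j∈q (trans (sym (adj-↑ʳ i j)) xy)
  ... | inj₁ (_ , _ , i∈p) | inj₂ (_ , _ , j∈q) = ⊥-elim (x∈p∧y∈q⇒¬[p≡⊥⊎q≡⊥] i∈p j∈q p≡⊥⊎q≡⊥)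
  ... | inj₂ (_ , _ , i∈q) | inj₁ (_ , _ , j∈p) = ⊥-elim (x∈p∧y∈q⇒¬[p≡⊥⊎q≡⊥] j∈p i∈q p≡⊥⊎q≡⊥)

  independent-++⁻ : ∀ {p q} → Independent (G ⊕ H) (p ++ q) →
                    Independent G p × Independent H q × (p ≡ ⊥ ⊎ q ≡ ⊥)
  independent-++⁻ {p} {q} ind = indG , indH , p≡⊥⊎q≡⊥
    where
    indG : Independent G p
    indG i j i∈p j∈p ij = ind _ _ (∈-++ˡ⁺ i∈p) (∈-++ˡ⁺ j∈p) (trans (adj-↑ˡ i j) ij)
    indH : Independent H q
    indH i j i∈q j∈q ij = ind _ _ (∈-++ʳ⁺ p i∈q) (∈-++ʳ⁺ p j∈q) (trans (adj-↑ʳ i j) ij)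
    p≡⊥⊎q≡⊥ : p ≡ ⊥ ⊎ q ≡ ⊥
    p≡⊥⊎q≡⊥ with nonempty? p
    ... | no p-empty = inj₁ (Empty-unique p-empty)
    ... | yes (i , i∈p) = inj₂ (Empty-unique λ (j , j∈q) →
                            ind _ _ (∈-++ˡ⁺ i∈p) (∈-++ʳ⁺ p j∈q) (edge-↑ˡ-↑ʳ i j))

  independenceNumber-⊕ : ∀ {a b} → IsIndependenceNumber G a → IsIndependenceNumber H b →
                         IsIndependenceNumber (G ⊕ H) (a ⊔ b)
  independenceNumber-⊕ {a} {b} ((S , indS , ∣S∣≡a) , boundG) ((T , indT , ∣T∣≡b) , boundH) =
    witness , bound
    where
    witness : ∃ λ U → Independent (G ⊕ H) U × ∣ U ∣ ≡ a ⊔ b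
    witness with ≤-total a b
    ... | inj₁ a≤b = ⊥ ++ T , independent-++⁺ (λ _ _ i∈⊥ → contradiction i∈⊥ ∉⊥) indT (inj₁ refl) ,
                     trans (∣⊥++q∣≡∣q∣ m T) (trans ∣T∣≡b (sym (m≤n⇒m⊔n≡n a≤b)))
    ... | inj₂ b≤a = S ++ ⊥ , independent-++⁺ indS (λ _ _ j∈⊥ → contradiction j∈⊥ ∉⊥) (inj₂ refl) ,
                     trans (∣p++⊥∣≡∣p∣ S) (trans ∣S∣≡a (sym (m≥n⇒m⊔n≡m b≤a)))
    bound : ∀ U → Independent (G ⊕ H) U → ∣ U ∣ ≤ a ⊔ b
    bound U indU with Vec.splitAt m U
    ... | p , q , refl with independent-++⁻ {p} {q} indU
    ... | _ , indq , inj₁ refl = subst (_≤ a ⊔ b) (sym (∣⊥++q∣≡∣q∣ m q)) (≤-trans (boundH q indq) (m≤n⊔m a b))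
    ... | indp , _ , inj₂ refl = subst (_≤ a ⊔ b) (sym (∣p++⊥∣≡∣p∣ p)) (≤-trans (boundG p indp) (m≤m⊔n a b))

joinSplitting : (G : Graph (suc m)) (H : Graph (suc n)) → JoinSplitting (G ⊕ H)
joinSplitting {m = m} {n = n} G H = record
  { side       = inG G H
  ; across     = λ {x} {y} → ⊕-across G H {x = x} {y = y}
  ; left       = zero ↑ˡ suc n
  ; right      = suc m ↑ʳ zero
  ; left≢right = λ left~right → contradiction (trans left~right (inG-↑ʳ G H zero)) λ ()
  }

theorem3p6 : (m n : ℕ) (G : Graph (suc m)) (H : Graph (suc n)) →
    Σ ℕ λ a → Σ ℕ λ b → Σ ℕ λ c →
      IsIndependenceNumber G a × IsIndependenceNumber H b × IsIndependenceNumber (G ⊕ H) c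
      × IsOptimalPeggingNumber (G ⊕ H) 2
      × IsPeggingNumber (G ⊕ H) (suc c)
      × c ≡ a ⊔ b
theorem3p6 m n G H with independenceNumber G | independenceNumber H
... | a , αG | b , αH =
  a , b , a ⊔ b , αG , αH , αG⊕H ,
  isOptimalPeggingNumber-2 (joinSplitting G H) , isPeggingNumber (joinSplitting G H) αG⊕H , refl
  where
  αG⊕H : IsIndependenceNumber (G ⊕ H) (a ⊔ b)
  αG⊕H = independenceNumber-⊕ G H αG αH
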